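{- Let $k$, $n$, $p$, $r$ and $t$ be positive integers with $t\le n$. Then $$w_{p,r}(n,k)=\sum_{i=0}^{n-k}w_{p,r}(t,t-i)\,w_{p,tp+r}(n-t,k-t+i).$$
   Context: For positive integers $p,r$ and an integer $N\ge0$, the $r$-Whitney numbers of the first kind $w_{p,r}(N,j)$, $0\le j\le N$, are defined by the polynomial identity in $x$: $p^N(x)_N=\sum_{j=0}^{N}w_{p,r}(N,j)(px+r)^j$, where $(x)_N=x(x-1)\cdots(x-N+1)$, $(x)_0=1$. Set $w_{p,r}(N,j)=0$ for $j<0$ or $j>N$; an empty sum is $0$. -}

module Defs where

open import Data.Nat using (ℕ; zero; suc)
open import Data.Integer using (ℤ; +_; -[1+_]; _+_; _*_; _-_; _^_)
open import Data.Bool using (if_then_else_)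
open import Relation.Binary.PropositionalEquality using (_≡_)

fall : ℤ → ℕ → ℤ
fall x zero = + 1
fall x (suc N) = fall x N * (x - + N)

sumBelow : ℕ → (ℕ → ℤ) → ℤ
sumBelow zero f = + 0
sumBelow (suc m) f = sumBelow m f + f m

sumTo : ℤ → (ℕ → ℤ) → ℤ
sumTo (+ m) f = sumBelow (suc m) f
sumTo -[1+ _ ] f = + 0

-- A family W p r N j (0 ≤ j ≤ N) satisfies the defining identity of the
-- r-Whitney numbers of the first kind, for all positive p, r, all N, and
-- all integer x:  p^N (x)_N = Σ_{j=0}^N W p r N j (p x + r)^j.
-- (Two integer polynomials agreeing on all of ℤ are equal, and the
-- coefficients in the basis (px+r)^j are unique since p ≠ 0.)
IsWhitney : (ℕ → ℕ → ℕ → ℕ → ℤ) → Set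
IsWhitney W = ∀ (p r : ℕ) → 1 Data.Nat.≤ p → 1 Data.Nat.≤ r → ∀ (N : ℕ) (x : ℤ) →
  (+ p) ^ N * fall x N ≡ sumBelow (suc N) (λ j → W p r N j * ((+ p) * x + + r) ^ j)

ext : (ℕ → ℕ → ℕ → ℕ → ℤ) → ℕ → ℕ → ℕ → ℤ → ℤ
ext W p r N (+ j) = if N Data.Nat.<ᵇ j then + 0 else W p r N j
ext W p r N -[1+ _ ] = + 0

-- Since (x)_{t+s} = (x)_t (x - t)_s and p x + r = p (x - t) + (t p + r), the
-- generating polynomial Σ_j w_{p,r}(t+s, j) y^j agrees with the product of
-- Σ_i w_{p,r}(t, i) y^i and Σ_j w_{p,tp+r}(s, j) y^j at the points y = p x + r,
-- which are pairwise distinct because p ≥ 1.  Hence the two polynomials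
-- coincide, and comparing coefficients of y^k gives a Cauchy convolution;
-- substituting i ↦ t - i and discarding the terms outside the supports turns
-- it into the stated sum.
module Submission where

open import Defs
open import Data.Nat using (ℕ; _≤_; _∸_)
open import Data.Integer using (ℤ; +_; _-_; _+_; _*_)
open import Relation.Binary.PropositionalEquality using (_≡_)

open import Data.Nat as ℕ using (zero; suc; _<_; s≤s)
import Data.Nat.Properties as ℕₚ
open import Data.Nat.Tactic.RingSolver using () renaming (solve-∀ to ℕ-solve-∀)
open import Data.Integer using (-[1+_]; _^_; 0ℤ; -1ℤ)
open import Data.Integer.Properties
  using (+-identityˡ; +-identityʳ; +-assoc; +-comm; *-zeroˡ; *-zeroʳ; *-distribˡ-+; *-identityʳ;
         +-inverseʳ; pos-+; pos-*; +-injective; ^-distribˡ-+-*; i*j≡0⇒i≡0∨j≡0; i-j≡0⇒i≡j;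
         [+m]-[+n]≡m⊖n; ⊖-≥; ⊖-<)
open import Data.Integer.Tactic.RingSolver using (solve-∀)
open import Data.List using (List; []; _∷_; length; map)
open import Data.List.Relation.Unary.All using (All; []; _∷_)
open import Data.Product using (_,_)
open import Data.Sum using (inj₁; inj₂)
open import Data.Bool using (true; false)
open import Data.Empty using (⊥-elim)
open import Function using (_∘_)
open import Function.Definitions using (Injective)
open import Relation.Nullary using (yes; no)
open import Relation.Nullary.Reflects using (ofʸ; ofⁿ)
open import Relation.Binary.PropositionalEquality
  using (refl; sym; trans; cong; cong₂; module ≡-Reasoning)

open ≡-Reasoning

sumBelow-cong : ∀ {n} {f g : ℕ → ℤ} → (∀ i → i < n → f i ≡ g i) → sumBelow n f ≡ sumBelow n g
sumBelow-cong {zero}  f≗g = refl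
sumBelow-cong {suc n} f≗g =
  cong₂ _+_ (sumBelow-cong (λ i i<n → f≗g i (ℕₚ.m<n⇒m<1+n i<n))) (f≗g n ℕₚ.≤-refl)

sumBelow-zero : ∀ n {f : ℕ → ℤ} → (∀ i → f i ≡ 0ℤ) → sumBelow n f ≡ 0ℤ
sumBelow-zero zero    f≡0 = refl
sumBelow-zero (suc n) f≡0 = cong₂ _+_ (sumBelow-zero n f≡0) (f≡0 n)

sumBelow-*ˡ : ∀ n c (f : ℕ → ℤ) → c * sumBelow n f ≡ sumBelow n (λ i → c * f i)
sumBelow-*ˡ zero    c f = *-zeroʳ c
sumBelow-*ˡ (suc n) c f =
  trans (*-distribˡ-+ c (sumBelow n f) (f n)) (cong (_+ c * f n) (sumBelow-*ˡ n c f))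

sumBelow-suc-head : ∀ n (f : ℕ → ℤ) → sumBelow (suc n) f ≡ f 0 + sumBelow n (f ∘ suc)
sumBelow-suc-head zero    f = +-comm 0ℤ (f 0)
sumBelow-suc-head (suc n) f =
  trans (cong (_+ f (suc n)) (sumBelow-suc-head n f)) (+-assoc (f 0) _ _)

sumBelow-reverse : ∀ n (f : ℕ → ℤ) → sumBelow n f ≡ sumBelow n (λ i → f (n ∸ suc i))
sumBelow-reverse zero    f = refl
sumBelow-reverse (suc n) f = begin
  sumBelow n f + f n                              ≡⟨ cong (_+ f n) (sumBelow-reverse n f) ⟩
  sumBelow n (λ i → f (n ∸ suc i)) + f n          ≡⟨ +-comm _ (f n) ⟩
  f n + sumBelow n (λ i → f (n ∸ suc i))          ≡⟨ sym (sumBelow-suc-head n (λ i → f (n ∸ i))) ⟩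
  sumBelow (suc n) (λ i → f (n ∸ i))              ∎

sumBelow-vanishing : ∀ {L M} (f : ℕ → ℤ) → L ≤ M → (∀ d → f (L ℕ.+ d) ≡ 0ℤ) →
                     sumBelow M f ≡ sumBelow L f
sumBelow-vanishing {L} f L≤M f≡0 with ℕₚ.m≤n⇒∃[o]m+o≡n L≤M
... | o , refl = extend o
  where
  extend : ∀ o → sumBelow (L ℕ.+ o) f ≡ sumBelow L f
  extend zero    = cong (λ n → sumBelow n f) (ℕₚ.+-identityʳ L)
  extend (suc o) rewrite ℕₚ.+-suc L o =
    trans (cong₂ _+_ (extend o) (f≡0 o)) (+-identityʳ (sumBelow L f))

sumBelow-support : ∀ {L M} (f : ℕ → ℤ) → (∀ d → f (L ℕ.+ d) ≡ 0ℤ) → (∀ d → f (M ℕ.+ d) ≡ 0ℤ) →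
                   sumBelow L f ≡ sumBelow M f
sumBelow-support {L} {M} f f≡0-beyond-L f≡0-beyond-M with ℕₚ.≤-total L M
... | inj₁ L≤M = sym (sumBelow-vanishing f L≤M f≡0-beyond-L)
... | inj₂ M≤L = sumBelow-vanishing f M≤L f≡0-beyond-M

[+m]-[+n]≡+[m∸n] : ∀ {m n} → n ≤ m → + m - + n ≡ + (m ∸ n)
[+m]-[+n]≡+[m∸n] {m} {n} n≤m = trans ([+m]-[+n]≡m⊖n m n) (⊖-≥ n≤m)

[+m]-[+1+m+d]≡-[1+d] : ∀ m d → + m - + (suc m ℕ.+ d) ≡ -[1+ d ]
[+m]-[+1+m+d]≡-[1+d] m d
  rewrite [+m]-[+n]≡m⊖n m (suc m ℕ.+ d) | ⊖-< (s≤s (ℕₚ.m≤m+n m d))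
        | ℕₚ.+-∸-assoc 1 (ℕₚ.m≤m+n m d) | ℕₚ.m+n∸m≡n m d = refl

sumTo-[n-k]-≥ : ∀ {n k} → k ≤ n → (f : ℕ → ℤ) → sumTo (+ n - + k) f ≡ sumBelow (suc (n ∸ k)) f
sumTo-[n-k]-≥ k≤n f rewrite [+m]-[+n]≡+[m∸n] k≤n = refl

sumTo-[n-k]-< : ∀ {n k} → n < k → (f : ℕ → ℤ) → sumTo (+ n - + k) f ≡ 0ℤ
sumTo-[n-k]-< {n} {suc k} n<k f
  rewrite [+m]-[+n]≡m⊖n n (suc k) | ⊖-< n<k | ℕₚ.+-∸-assoc 1 (ℕₚ.≤-pred n<k) = refl

record SupportedIn (N : ℕ) (a : ℤ → ℤ) : Set where
  field
    vanishes-below : ∀ d → a -[1+ d ] ≡ 0ℤ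
    vanishes-above : ∀ d → a (+ (suc N ℕ.+ d)) ≡ 0ℤ

reflected-index : ∀ {k m t s} d → k ℕ.+ m ≡ t ℕ.+ s → + k - (+ t - + (suc m ℕ.+ d)) ≡ + (suc s ℕ.+ d)
reflected-index {k} {m} {t} {s} d k+m≡t+s = begin
  + k - (+ t - + (suc m ℕ.+ d))       ≡⟨ rearrange (+ k) (+ t) (+ (suc m ℕ.+ d)) ⟩
  + k + + (suc m ℕ.+ d) - + t         ≡⟨ cong (λ z → z - + t) (sym (pos-+ k (suc m ℕ.+ d))) ⟩
  + (k ℕ.+ (suc m ℕ.+ d)) - + t       ≡⟨ cong (λ n → + n - + t) k+1+m+d≡t+1+s+d ⟩
  + (t ℕ.+ (suc s ℕ.+ d)) - + t       ≡⟨ [+m]-[+n]≡+[m∸n] (ℕₚ.m≤m+n t (suc s ℕ.+ d)) ⟩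
  + (t ℕ.+ (suc s ℕ.+ d) ∸ t)         ≡⟨ cong +_ (ℕₚ.m+n∸m≡n t (suc s ℕ.+ d)) ⟩
  + (suc s ℕ.+ d)                     ∎
  where
  rearrange : ∀ k t x → k - (t - x) ≡ k + x - t
  rearrange = solve-∀
  shuffle : ∀ a b d → a ℕ.+ (suc b ℕ.+ d) ≡ suc (a ℕ.+ b ℕ.+ d)
  shuffle = ℕ-solve-∀
  k+1+m+d≡t+1+s+d : k ℕ.+ (suc m ℕ.+ d) ≡ t ℕ.+ (suc s ℕ.+ d)
  k+1+m+d≡t+1+s+d =
    trans (shuffle k m d) (trans (cong (λ n → suc (n ℕ.+ d)) k+m≡t+s) (sym (shuffle t s d)))

convolution-reversed : ∀ {t s} {a b : ℤ → ℤ} → SupportedIn t a → SupportedIn s b →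
  ∀ k m → k ℕ.+ m ≡ t ℕ.+ s →
  sumBelow (suc k) (λ i → a (+ i) * b (+ (k ∸ i))) ≡
  sumBelow (suc m) (λ i → a (+ t - + i) * b (+ k - + t + + i))
convolution-reversed {t} {s} {a} {b} a-supp b-supp k m k+m≡t+s = begin
  sumBelow (suc k) (λ i → a (+ i) * b (+ (k ∸ i)))
    ≡⟨ sumBelow-cong {suc k} (λ i i≤k → cong (λ z → a (+ i) * b z) (sym ([+m]-[+n]≡+[m∸n] (ℕₚ.≤-pred i≤k)))) ⟩
  sumBelow (suc k) (G ∘ +_)
    ≡⟨ sumBelow-support (G ∘ +_)
         (λ d → b-vanishes (trans (cong b ([+m]-[+1+m+d]≡-[1+d] k d)) (b≡0-below d)))
         (λ d → a-vanishes (a≡0-above d)) ⟩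
  sumBelow (suc t) (G ∘ +_)
    ≡⟨ sumBelow-reverse (suc t) (G ∘ +_) ⟩
  sumBelow (suc t) (λ i → G (+ (t ∸ i)))
    ≡⟨ sumBelow-cong {suc t} (λ i i≤t → cong G (sym ([+m]-[+n]≡+[m∸n] (ℕₚ.≤-pred i≤t)))) ⟩
  sumBelow (suc t) (λ i → G (+ t - + i))
    ≡⟨ sumBelow-support (λ i → G (+ t - + i))
         (λ d → a-vanishes (trans (cong a ([+m]-[+1+m+d]≡-[1+d] t d)) (a≡0-below d)))
         (λ d → b-vanishes (trans (cong b (reflected-index d k+m≡t+s)) (b≡0-above d))) ⟩
  sumBelow (suc m) (λ i → G (+ t - + i))
    ≡⟨ sumBelow-cong {suc m} (λ i _ → cong (λ z → a (+ t - + i) * b z) (rearrange (+ k) (+ t) (+ i))) ⟩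
  sumBelow (suc m) (λ i → a (+ t - + i) * b (+ k - + t + + i)) ∎
  where
  open SupportedIn a-supp renaming (vanishes-below to a≡0-below; vanishes-above to a≡0-above)
  open SupportedIn b-supp renaming (vanishes-below to b≡0-below; vanishes-above to b≡0-above)
  G : ℤ → ℤ
  G z = a z * b (+ k - z)
  a-vanishes : ∀ {z} → a z ≡ 0ℤ → G z ≡ 0ℤ
  a-vanishes {z} a≡0 = trans (cong (λ e → e * b (+ k - z)) a≡0) (*-zeroˡ (b (+ k - z)))
  b-vanishes : ∀ {z} → b (+ k - z) ≡ 0ℤ → G z ≡ 0ℤ
  b-vanishes {z} b≡0 = trans (cong (a z *_) b≡0) (*-zeroʳ (a z))
  rearrange : ∀ k t i → k - (t - i) ≡ k - t + i
  rearrange = solve-∀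

-- Polynomials as lists of coefficients, constant term first

Poly : Set
Poly = List ℤ

eval : Poly → ℤ → ℤ
eval []       y = 0ℤ
eval (c ∷ cs) y = c + y * eval cs y

coeff : Poly → ℕ → ℤ
coeff []       k       = 0ℤ
coeff (c ∷ cs) zero    = c
coeff (c ∷ cs) (suc k) = coeff cs k

infixl 6 _+ₚ_ _-ₚ_
infixl 7 _*ₚ_ _·ₚ_

_+ₚ_ : Poly → Poly → Poly
[]       +ₚ q        = q
(a ∷ p)  +ₚ []       = a ∷ p
(a ∷ p)  +ₚ (b ∷ q)  = a + b ∷ p +ₚ q

_·ₚ_ : ℤ → Poly → Poly
c ·ₚ p = map (c *_) p

_*ₚ_ : Poly → Poly → Poly
[]       *ₚ q = []
(c ∷ cs) *ₚ q = c ·ₚ q +ₚ (0ℤ ∷ cs *ₚ q)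

_-ₚ_ : Poly → Poly → Poly
p -ₚ q = p +ₚ -1ℤ ·ₚ q

fromCoeffs : ℕ → (ℕ → ℤ) → Poly
fromCoeffs zero    f = []
fromCoeffs (suc N) f = f 0 ∷ fromCoeffs N (f ∘ suc)

eval-+ₚ : ∀ p q y → eval (p +ₚ q) y ≡ eval p y + eval q y
eval-+ₚ []      q       y = sym (+-identityˡ _)
eval-+ₚ (a ∷ p) []      y = sym (+-identityʳ _)
eval-+ₚ (a ∷ p) (b ∷ q) y = trans (cong (λ e → a + b + y * e) (eval-+ₚ p q y))
                                  (rearrange a b y (eval p y) (eval q y))
  where
  rearrange : ∀ a b y u v → a + b + y * (u + v) ≡ a + y * u + (b + y * v)
  rearrange = solve-∀

eval-·ₚ : ∀ c p y → eval (c ·ₚ p) y ≡ c * eval p y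
eval-·ₚ c []      y = sym (*-zeroʳ c)
eval-·ₚ c (a ∷ p) y = trans (cong (λ e → c * a + y * e) (eval-·ₚ c p y)) (rearrange c a y (eval p y))
  where
  rearrange : ∀ c a y u → c * a + y * (c * u) ≡ c * (a + y * u)
  rearrange = solve-∀

eval-*ₚ : ∀ p q y → eval (p *ₚ q) y ≡ eval p y * eval q y
eval-*ₚ []       q y = refl
eval-*ₚ (c ∷ cs) q y = begin
  eval (c ·ₚ q +ₚ (0ℤ ∷ cs *ₚ q)) y
    ≡⟨ eval-+ₚ (c ·ₚ q) (0ℤ ∷ cs *ₚ q) y ⟩
  eval (c ·ₚ q) y + (0ℤ + y * eval (cs *ₚ q) y)
    ≡⟨ cong₂ (λ u v → u + (0ℤ + y * v)) (eval-·ₚ c q y) (eval-*ₚ cs q y) ⟩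
  c * eval q y + (0ℤ + y * (eval cs y * eval q y))
    ≡⟨ rearrange c y (eval cs y) (eval q y) ⟩
  (c + y * eval cs y) * eval q y            ∎
  where
  rearrange : ∀ c y u v → c * v + (0ℤ + y * (u * v)) ≡ (c + y * u) * v
  rearrange = solve-∀

eval--ₚ : ∀ p q y → eval (p -ₚ q) y ≡ eval p y - eval q y
eval--ₚ p q y = begin
  eval (p +ₚ -1ℤ ·ₚ q) y           ≡⟨ eval-+ₚ p (-1ℤ ·ₚ q) y ⟩
  eval p y + eval (-1ℤ ·ₚ q) y     ≡⟨ cong (λ e → eval p y + e) (eval-·ₚ -1ℤ q y) ⟩
  eval p y + -1ℤ * eval q y        ≡⟨ rearrange (eval p y) (eval q y) ⟩
  eval p y - eval q y              ∎
  where
  rearrange : ∀ u v → u + -1ℤ * v ≡ u - v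
  rearrange = solve-∀

eval-fromCoeffs : ∀ N f y → eval (fromCoeffs N f) y ≡ sumBelow N (λ j → f j * y ^ j)
eval-fromCoeffs zero    f y = refl
eval-fromCoeffs (suc N) f y = begin
  f 0 + y * eval (fromCoeffs N (f ∘ suc)) y
    ≡⟨ cong (λ e → f 0 + y * e) (eval-fromCoeffs N (f ∘ suc) y) ⟩
  f 0 + y * sumBelow N (λ j → f (suc j) * y ^ j)
    ≡⟨ cong₂ _+_ (sym (*-identityʳ (f 0))) (sumBelow-*ˡ N y _) ⟩
  f 0 * + 1 + sumBelow N (λ j → y * (f (suc j) * y ^ j))
    ≡⟨ cong (λ e → f 0 * + 1 + e) (sumBelow-cong {N} (λ j _ → rearrange y (f (suc j)) (y ^ j))) ⟩
  f 0 * + 1 + sumBelow N (λ j → f (suc j) * y ^ suc j)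
    ≡⟨ sym (sumBelow-suc-head N (λ j → f j * y ^ j)) ⟩
  sumBelow (suc N) (λ j → f j * y ^ j) ∎
  where
  rearrange : ∀ y a b → y * (a * b) ≡ a * (y * b)
  rearrange = solve-∀

coeff-+ₚ : ∀ p q k → coeff (p +ₚ q) k ≡ coeff p k + coeff q k
coeff-+ₚ []      q       k       = sym (+-identityˡ _)
coeff-+ₚ (a ∷ p) []      zero    = sym (+-identityʳ a)
coeff-+ₚ (a ∷ p) []      (suc k) = sym (+-identityʳ _)
coeff-+ₚ (a ∷ p) (b ∷ q) zero    = refl
coeff-+ₚ (a ∷ p) (b ∷ q) (suc k) = coeff-+ₚ p q k

coeff-·ₚ : ∀ c p k → coeff (c ·ₚ p) k ≡ c * coeff p k
coeff-·ₚ c []      k       = sym (*-zeroʳ c)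
coeff-·ₚ c (a ∷ p) zero    = refl
coeff-·ₚ c (a ∷ p) (suc k) = coeff-·ₚ c p k

coeff-*ₚ : ∀ p q k → coeff (p *ₚ q) k ≡ sumBelow (suc k) (λ i → coeff p i * coeff q (k ∸ i))
coeff-*ₚ []       q k       = sym (sumBelow-zero (suc k) (λ _ → refl))
coeff-*ₚ (c ∷ cs) q zero    =
  trans (coeff-+ₚ (c ·ₚ q) (0ℤ ∷ cs *ₚ q) 0)
        (trans (+-identityʳ _) (trans (coeff-·ₚ c q 0) (sym (+-identityˡ _))))
coeff-*ₚ (c ∷ cs) q (suc k) = begin
  coeff (c ·ₚ q +ₚ (0ℤ ∷ cs *ₚ q)) (suc k)
    ≡⟨ coeff-+ₚ (c ·ₚ q) (0ℤ ∷ cs *ₚ q) (suc k) ⟩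
  coeff (c ·ₚ q) (suc k) + coeff (cs *ₚ q) k
    ≡⟨ cong₂ _+_ (coeff-·ₚ c q (suc k)) (coeff-*ₚ cs q k) ⟩
  c * coeff q (suc k) + sumBelow (suc k) (λ i → coeff cs i * coeff q (k ∸ i))
    ≡⟨ sym (sumBelow-suc-head (suc k) (λ i → coeff (c ∷ cs) i * coeff q (suc k ∸ i))) ⟩
  sumBelow (suc (suc k)) (λ i → coeff (c ∷ cs) i * coeff q (suc k ∸ i)) ∎

coeff--ₚ : ∀ p q k → coeff (p -ₚ q) k ≡ coeff p k - coeff q k
coeff--ₚ p q k = begin
  coeff (p +ₚ -1ℤ ·ₚ q) k          ≡⟨ coeff-+ₚ p (-1ℤ ·ₚ q) k ⟩
  coeff p k + coeff (-1ℤ ·ₚ q) k   ≡⟨ cong (λ e → coeff p k + e) (coeff-·ₚ -1ℤ q k) ⟩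
  coeff p k + -1ℤ * coeff q k      ≡⟨ rearrange (coeff p k) (coeff q k) ⟩
  coeff p k - coeff q k            ∎
  where
  rearrange : ∀ u v → u + -1ℤ * v ≡ u - v
  rearrange = solve-∀

coeff-fromCoeffs-< : ∀ {N k} f → k < N → coeff (fromCoeffs N f) k ≡ f k
coeff-fromCoeffs-< {suc N} {zero}  f _   = refl
coeff-fromCoeffs-< {suc N} {suc k} f k<N = coeff-fromCoeffs-< (f ∘ suc) (ℕₚ.≤-pred k<N)

coeff-fromCoeffs-≥ : ∀ {N k} f → N ≤ k → coeff (fromCoeffs N f) k ≡ 0ℤ
coeff-fromCoeffs-≥ {zero}  {k}     f _   = refl
coeff-fromCoeffs-≥ {suc N} {suc k} f N≤k = coeff-fromCoeffs-≥ (f ∘ suc) (ℕₚ.≤-pred N≤k)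

-- A polynomial vanishing at infinitely many points is zero

-- quot a cs is the quotient of  y · P(y) - a · P(a)  by  y - a,  for P = eval cs.
quot : ℤ → Poly → Poly
quot a []       = []
quot a (c ∷ cs) = eval (c ∷ cs) a ∷ quot a cs

length-quot : ∀ a cs → length (quot a cs) ≡ length cs
length-quot a []       = refl
length-quot a (c ∷ cs) = cong suc (length-quot a cs)

eval-quot : ∀ a cs y → y * eval cs y ≡ a * eval cs a + (y - a) * eval (quot a cs) y
eval-quot a []       y = rearrange a y
  where
  rearrange : ∀ a y → y * 0ℤ ≡ a * 0ℤ + (y - a) * 0ℤ
  rearrange = solve-∀
eval-quot a (c ∷ cs) y = begin
  y * (c + y * eval cs y)
    ≡⟨ cong (λ e → y * (c + e)) (eval-quot a cs y) ⟩
  y * (c + (a * eval cs a + (y - a) * eval (quot a cs) y))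
    ≡⟨ rearrange a c y (eval cs a) (eval (quot a cs) y) ⟩
  a * (c + a * eval cs a) + (y - a) * ((c + a * eval cs a) + y * eval (quot a cs) y) ∎
  where
  rearrange : ∀ a c y P Q → y * (c + (a * P + (y - a) * Q)) ≡ a * (c + a * P) + (y - a) * ((c + a * P) + y * Q)
  rearrange = solve-∀

eval-zeros : ∀ {cs} y → All (_≡ 0ℤ) cs → eval cs y ≡ 0ℤ
eval-zeros          y []            = refl
eval-zeros {_ ∷ cs} y (refl ∷ cs≡0) = begin
  0ℤ + y * eval cs y  ≡⟨ +-identityˡ _ ⟩
  y * eval cs y       ≡⟨ cong (y *_) (eval-zeros y cs≡0) ⟩
  y * 0ℤ              ≡⟨ *-zeroʳ y ⟩
  0ℤ                  ∎

coeff-zeros : ∀ {cs} k → All (_≡ 0ℤ) cs → coeff cs k ≡ 0ℤ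
coeff-zeros k       []            = refl
coeff-zeros zero    (c≡0 ∷ _)     = c≡0
coeff-zeros (suc k) (_ ∷ cs≡0)    = coeff-zeros k cs≡0

quot-zeros⇒zeros : ∀ a cs → All (_≡ 0ℤ) (quot a cs) → All (_≡ 0ℤ) cs
quot-zeros⇒zeros a []       []               = []
quot-zeros⇒zeros a (c ∷ cs) (Pa≡0 ∷ quot≡0) = c≡0 ∷ cs≡0
  where
  cs≡0 : All (_≡ 0ℤ) cs
  cs≡0 = quot-zeros⇒zeros a cs quot≡0
  c≡0 : c ≡ 0ℤ
  c≡0 = begin
    c                  ≡⟨ sym (+-identityʳ c) ⟩
    c + 0ℤ             ≡⟨ cong (λ e → c + e) (sym (*-zeroʳ a)) ⟩
    c + a * 0ℤ         ≡⟨ cong (λ e → c + a * e) (sym (eval-zeros a cs≡0)) ⟩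
    eval (c ∷ cs) a    ≡⟨ Pa≡0 ⟩
    0ℤ                 ∎

zeros-of-roots : ∀ cs (y : ℕ → ℤ) → Injective _≡_ _≡_ y → (∀ x → eval cs (y x) ≡ 0ℤ) →
                 All (_≡ 0ℤ) cs
zeros-of-roots cs = go (length cs) cs refl
  where
  go : ∀ n cs → length cs ≡ n → (y : ℕ → ℤ) → Injective _≡_ _≡_ y →
       (∀ x → eval cs (y x) ≡ 0ℤ) → All (_≡ 0ℤ) cs
  go _       []       _   _ _     _     = []
  go (suc n) (c ∷ cs) len y y-inj roots =
    quot-zeros⇒zeros a (c ∷ cs) (P[a]≡0 ∷ go n Q Q-length (y ∘ suc) (ℕₚ.suc-injective ∘ y-inj) Q-roots)
    where
    a : ℤ
    a = y 0
    P : ℤ → ℤ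
    P = eval (c ∷ cs)
    Q : Poly
    Q = quot a cs
    P[a]≡0 : P a ≡ 0ℤ
    P[a]≡0 = roots 0
    Q-length : length Q ≡ n
    Q-length = trans (length-quot a cs) (ℕₚ.suc-injective len)
    factor : ∀ z → (z - a) * eval Q z ≡ P z
    factor z = begin
      (z - a) * eval Q z                        ≡⟨ sym (+-identityˡ _) ⟩
      0ℤ + (z - a) * eval Q z                   ≡⟨ cong (_+ (z - a) * eval Q z) (sym P[a]≡0) ⟩
      P a + (z - a) * eval Q z                  ≡⟨ +-assoc c _ _ ⟩
      c + (a * eval cs a + (z - a) * eval Q z)  ≡⟨ cong (λ e → c + e) (sym (eval-quot a cs z)) ⟩
      P z                                       ∎
    Q-roots : ∀ x → eval Q (y (suc x)) ≡ 0ℤ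
    Q-roots x with i*j≡0⇒i≡0∨j≡0 (y (suc x) - a) (trans (factor (y (suc x))) (roots (suc x)))
    ... | inj₁ y[1+x]-a≡0 = ⊥-elim (ℕₚ.1+n≢0 (y-inj (i-j≡0⇒i≡j _ _ y[1+x]-a≡0)))
    ... | inj₂ Q≡0        = Q≡0

coeff-unique : ∀ p q (y : ℕ → ℤ) → Injective _≡_ _≡_ y → (∀ x → eval p (y x) ≡ eval q (y x)) →
               ∀ k → coeff p k ≡ coeff q k
coeff-unique p q y y-inj agree k = i-j≡0⇒i≡j _ _ (begin
  coeff p k - coeff q k  ≡⟨ sym (coeff--ₚ p q k) ⟩
  coeff (p -ₚ q) k       ≡⟨ coeff-zeros k (zeros-of-roots (p -ₚ q) y y-inj roots) ⟩
  0ℤ                     ∎)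
  where
  roots : ∀ x → eval (p -ₚ q) (y x) ≡ 0ℤ
  roots x = trans (eval--ₚ p q (y x))
                  (trans (cong (λ e → eval p (y x) - e) (sym (agree x))) (+-inverseʳ (eval p (y x))))

fall-+ : ∀ x t s → fall x (t ℕ.+ s) ≡ fall x t * fall (x - + t) s
fall-+ x t zero    = trans (cong (fall x) (ℕₚ.+-identityʳ t)) (sym (*-identityʳ (fall x t)))
fall-+ x t (suc s) = begin
  fall x (t ℕ.+ suc s)                              ≡⟨ cong (fall x) (ℕₚ.+-suc t s) ⟩
  fall x (t ℕ.+ s) * (x - + (t ℕ.+ s))              ≡⟨ cong₂ (λ u v → u * (x - v)) (fall-+ x t s) (pos-+ t s) ⟩
  fall x t * fall (x - + t) s * (x - (+ t + + s))   ≡⟨ rearrange (fall x t) (fall (x - + t) s) x (+ t) (+ s) ⟩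
  fall x t * (fall (x - + t) s * (x - + t - + s))   ∎
  where
  rearrange : ∀ a b x t s → a * b * (x - (t + s)) ≡ a * (b * (x - t - s))
  rearrange = solve-∀

whitneyPoly : (ℕ → ℕ → ℕ → ℕ → ℤ) → ℕ → ℕ → ℕ → Poly
whitneyPoly W p r N = fromCoeffs (suc N) (W p r N)

coeff-whitneyPoly : ∀ W p r N k → coeff (whitneyPoly W p r N) k ≡ ext W p r N (+ k)
coeff-whitneyPoly W p r N k with N ℕ.<ᵇ k | ℕₚ.<ᵇ-reflects-< N k
... | true  | ofʸ N<k = coeff-fromCoeffs-≥ (W p r N) N<k
... | false | ofⁿ N≮k = coeff-fromCoeffs-< (W p r N) (s≤s (ℕₚ.≮⇒≥ N≮k))

eval-whitneyPoly : ∀ W → IsWhitney W → ∀ {p r} → 1 ≤ p → 1 ≤ r → ∀ N x →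
                   eval (whitneyPoly W p r N) (+ p * x + + r) ≡ (+ p) ^ N * fall x N
eval-whitneyPoly W isW {p} {r} p≥1 r≥1 N x =
  trans (eval-fromCoeffs (suc N) (W p r N) (+ p * x + + r)) (sym (isW p r p≥1 r≥1 N x))

affine-injective : ∀ {p} r → 1 ≤ p → Injective _≡_ _≡_ (λ x → + p * + x + + r)
affine-injective {p} r p≥1 {x} {x′} px+r≡px′+r =
  ℕₚ.*-cancelˡ-≡ x x′ p {{ℕ.>-nonZero p≥1}}
    (ℕₚ.+-cancelʳ-≡ r _ _ (+-injective (trans (embed x) (trans px+r≡px′+r (sym (embed x′))))))
  where
  embed : ∀ x → + (p ℕ.* x ℕ.+ r) ≡ + p * + x + + r
  embed x = trans (pos-+ (p ℕ.* x) r) (cong (_+ + r) (pos-* p x))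

affine-shift : ∀ p r t x → + p * (x - + t) + + (t ℕ.* p ℕ.+ r) ≡ + p * x + + r
affine-shift p r t x = begin
  + p * (x - + t) + + (t ℕ.* p ℕ.+ r)     ≡⟨ cong (λ e → + p * (x - + t) + e) (pos-+ (t ℕ.* p) r) ⟩
  + p * (x - + t) + (+ (t ℕ.* p) + + r)   ≡⟨ cong (λ e → + p * (x - + t) + (e + + r)) (pos-* t p) ⟩
  + p * (x - + t) + (+ t * + p + + r)     ≡⟨ rearrange (+ p) x (+ t) (+ r) ⟩
  + p * x + + r                           ∎
  where
  rearrange : ∀ p x t r → p * (x - t) + (t * p + r) ≡ p * x + r
  rearrange = solve-∀

whitney-convolution : ∀ W → IsWhitney W → ∀ {p r} → 1 ≤ p → 1 ≤ r → ∀ t s k →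
  ext W p r (t ℕ.+ s) (+ k) ≡
  sumBelow (suc k) (λ i → ext W p r t (+ i) * ext W p (t ℕ.* p ℕ.+ r) s (+ (k ∸ i)))
whitney-convolution W isW {p} {r} p≥1 r≥1 t s k = begin
  ext W p r (t ℕ.+ s) (+ k)
    ≡⟨ sym (coeff-whitneyPoly W p r (t ℕ.+ s) k) ⟩
  coeff Pₜ₊ₛ k
    ≡⟨ coeff-unique Pₜ₊ₛ (Pₜ *ₚ Pₛ) node (affine-injective r p≥1) agree k ⟩
  coeff (Pₜ *ₚ Pₛ) k
    ≡⟨ coeff-*ₚ Pₜ Pₛ k ⟩
  sumBelow (suc k) (λ i → coeff Pₜ i * coeff Pₛ (k ∸ i))
    ≡⟨ sumBelow-cong {suc k} (λ i _ → cong₂ _*_ (coeff-whitneyPoly W p r t i)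
                                                (coeff-whitneyPoly W p r′ s (k ∸ i))) ⟩
  sumBelow (suc k) (λ i → ext W p r t (+ i) * ext W p r′ s (+ (k ∸ i))) ∎
  where
  r′ : ℕ
  r′ = t ℕ.* p ℕ.+ r
  Pₜ₊ₛ Pₜ Pₛ : Poly
  Pₜ₊ₛ = whitneyPoly W p r (t ℕ.+ s)
  Pₜ   = whitneyPoly W p r t
  Pₛ   = whitneyPoly W p r′ s
  node : ℕ → ℤ
  node x = + p * + x + + r
  agree : ∀ x → eval Pₜ₊ₛ (node x) ≡ eval (Pₜ *ₚ Pₛ) (node x)
  agree x = begin
    eval Pₜ₊ₛ (node x)
      ≡⟨ eval-whitneyPoly W isW p≥1 r≥1 (t ℕ.+ s) (+ x) ⟩
    (+ p) ^ (t ℕ.+ s) * fall (+ x) (t ℕ.+ s)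
      ≡⟨ cong₂ _*_ (^-distribˡ-+-* (+ p) t s) (fall-+ (+ x) t s) ⟩
    ((+ p) ^ t * (+ p) ^ s) * (fall (+ x) t * fall (+ x - + t) s)
      ≡⟨ interchange ((+ p) ^ t) ((+ p) ^ s) (fall (+ x) t) (fall (+ x - + t) s) ⟩
    ((+ p) ^ t * fall (+ x) t) * ((+ p) ^ s * fall (+ x - + t) s)
      ≡⟨ cong₂ _*_ (sym (eval-whitneyPoly W isW p≥1 r≥1 t (+ x)))
                   (sym (eval-whitneyPoly W isW p≥1 (ℕₚ.≤-trans r≥1 (ℕₚ.m≤n+m r (t ℕ.* p))) s (+ x - + t))) ⟩
    eval Pₜ (node x) * eval Pₛ (+ p * (+ x - + t) + + r′)
      ≡⟨ cong (λ z → eval Pₜ (node x) * eval Pₛ z) (affine-shift p r t (+ x)) ⟩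
    eval Pₜ (node x) * eval Pₛ (node x)
      ≡⟨ sym (eval-*ₚ Pₜ Pₛ (node x)) ⟩
    eval (Pₜ *ₚ Pₛ) (node x) ∎
    where
    interchange : ∀ a b c d → (a * b) * (c * d) ≡ (a * c) * (b * d)
    interchange = solve-∀

ext-beyond : ∀ W p r N {j} → N < j → ext W p r N (+ j) ≡ 0ℤ
ext-beyond W p r N N<j = trans (sym (coeff-whitneyPoly W p r N _)) (coeff-fromCoeffs-≥ (W p r N) N<j)

ext-supported : ∀ W p r N → SupportedIn N (ext W p r N)
ext-supported W p r N = record
  { vanishes-below = λ _ → refl
  ; vanishes-above = λ d → ext-beyond W p r N (ℕₚ.m≤m+n (suc N) d)
  }

corollary3p3 : (W : ℕ → ℕ → ℕ → ℕ → ℤ) → IsWhitney W →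
    (k n p r t : ℕ) → 1 ≤ k → 1 ≤ n → 1 ≤ p → 1 ≤ r → 1 ≤ t → t ≤ n →
    ext W p r n (+ k) ≡
      sumTo (+ n - + k) (λ i →
        ext W p r t (+ t - + i) * ext W p (t Data.Nat.* p Data.Nat.+ r) (n ∸ t) (+ k - + t + + i))
corollary3p3 W isW k n p r t _ _ p≥1 r≥1 _ t≤n with k ℕ.≤? n
... | no k≰n = trans (ext-beyond W p r n (ℕₚ.≰⇒> k≰n)) (sym (sumTo-[n-k]-< (ℕₚ.≰⇒> k≰n) _))
... | yes k≤n = begin
  ext W p r n (+ k)
    ≡⟨ cong (λ N → ext W p r N (+ k)) (sym t+s≡n) ⟩
  ext W p r (t ℕ.+ s) (+ k)
    ≡⟨ whitney-convolution W isW p≥1 r≥1 t s k ⟩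
  sumBelow (suc k) (λ i → ext W p r t (+ i) * ext W p r′ s (+ (k ∸ i)))
    ≡⟨ convolution-reversed (ext-supported W p r t) (ext-supported W p r′ s) k (n ∸ k)
                            (trans (ℕₚ.m+[n∸m]≡n k≤n) (sym t+s≡n)) ⟩
  sumBelow (suc (n ∸ k)) (λ i → ext W p r t (+ t - + i) * ext W p r′ s (+ k - + t + + i))
    ≡⟨ sym (sumTo-[n-k]-≥ k≤n _) ⟩
  sumTo (+ n - + k) (λ i → ext W p r t (+ t - + i) * ext W p r′ s (+ k - + t + + i)) ∎
  where
  s r′ : ℕ
  s  = n ∸ t
  r′ = t ℕ.* p ℕ.+ r
  t+s≡n : t ℕ.+ s ≡ n
  t+s≡n = ℕₚ.m+[n∸m]≡n t≤n
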